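{- Let $s\ge 3$. There is no infinite connected cubic $s$-arc-transitive graph of girth $6$.
   Context: An $s$-arc is a sequence of vertices $x_0x_1\cdots x_s$ with $x_ix_{i+1}$ edges and $x_i\neq x_{i+2}$; a graph is $s$-arc-transitive if its automorphism group acts transitively on its $s$-arcs. The girth is the length of a shortest cycle. -}

module Defs where

open import Level using (Level; _⊔_; suc)
open import Data.Nat using (ℕ; zero; _<_; _≤_; _+_; z≤n; s≤s) renaming (suc to sucℕ)
open import Data.Fin using (Fin)
open import Data.Product using (Σ; ∃; ∃-syntax; _×_; _,_)
open import Relation.Binary.PropositionalEquality using (_≡_; _≢_)
open import Relation.Nullary using (¬_)
open import Function.Bundles using (_↔_; _⇔_)

record Graph (a b : Level) : Set (Level.suc (a ⊔ b)) where
  field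
    V      : Set a
    E      : V → V → Set b
    E-prop : ∀ {u v} (p q : E u v) → p ≡ q
    E-sym  : ∀ {u v} → E u v → E v u
    E-irr  : ∀ {u} → ¬ E u u

module _ {a b : Level} (G : Graph a b) where
  open Graph G

  N : V → Set (a ⊔ b)
  N v = Σ V (E v)

  Cubic : Set (a ⊔ b)
  Cubic = ∀ v → N v ↔ Fin 3

  Infinite : Set a
  Infinite = ∀ n → ¬ (V ↔ Fin n)

  IsWalk : ℕ → (ℕ → V) → Set b
  IsWalk n x = ∀ i → i < n → E (x i) (x (sucℕ i))

  Connected : Set (a ⊔ b)
  Connected = ∀ u w → ∃[ n ] ∃[ x ] (IsWalk n x × x 0 ≡ u × x n ≡ w)

  IsArc : ℕ → (ℕ → V) → Set (a ⊔ b)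
  IsArc s x = IsWalk s x × (∀ i → i + 2 ≤ s → x i ≢ x (i + 2))

  record Automorphism : Set (a ⊔ b) where
    field
      perm    : V ↔ V
      preserv : ∀ u v → E u v ⇔ E (Function.Bundles.Inverse.to perm u) (Function.Bundles.Inverse.to perm v)

  ArcTransitive : ℕ → Set (a ⊔ b)
  ArcTransitive s = ∀ x y → IsArc s x → IsArc s y →
    Σ Automorphism λ σ → ∀ i → i ≤ s → Function.Bundles.Inverse.to (Automorphism.perm σ) (x i) ≡ y i

  IsCycle : ℕ → (ℕ → V) → Set (a ⊔ b)
  IsCycle k x = 3 ≤ k × IsWalk k x × x k ≡ x 0 ×
                (∀ i j → i < k → j < k → x i ≡ x j → i ≡ j)

  HasCycle : ℕ → Set (a ⊔ b)
  HasCycle k = ∃[ x ] IsCycle k x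

  Girth : ℕ → Set (a ⊔ b)
  Girth g = HasCycle g × (∀ k → k < g → ¬ HasCycle k)

{-# OPTIONS --safe #-}

-- Via arcs extended to non-backtracking rays, s-arc-transitivity gives 3-arc-transitivity, so
-- every 3-arc lies on a hexagon.  Fix a vertex v₀ and take a geodesic p w u x to a vertex x at
-- distance d + 3; the hexagon through it returns from x to p by a second neighbour of x at
-- distance d + 2.  So every vertex at distance ≥ 3 has two inner neighbours, hence (degree 3) at
-- most one outer one, and outward paths from a fixed vertex are unique.  A vertex at distance 10
-- then has 2⁷ distinct ancestors at distance 3, more than the 4³ words describing the ball of
-- radius 3.  Thus the ball of radius 9 is everything, and the graph is finite.  Constructively
-- the last step runs under double negation: the finitely many equalities between the 4⁹
-- candidate vertices, and the finitely many neighbour relations, are decided there, and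
-- connectivity turns the resulting finite neighbour table into a bijection V ↔ Fin m.
module Submission where

open import Defs
open import Level using (Level; _⊔_)
open import Data.Nat using (ℕ; zero; suc; _+_; _^_; _≤_; _<_; z≤n; s≤s; z<s; s<s)
open import Data.Empty using (⊥)
open import Data.Nat.Properties
  using (≤-trans; <-trans; m+n≤o⇒n≤o; ≤-<-trans; <⇒≢; m<m+n; m≤m+n; m<n⇒m<1+n; n<1+n)
open import Data.Fin using (Fin; zero; suc; punchIn)
open import Data.Fin.Properties using (punchOut-injective; punchInᵢ≢i; any?; ∀-cons; *↔×; <⇒notInjective)
open import Data.Vec using (Vec; []; _∷_; uncons)
open import Data.Product using (∃-syntax; ∃₂; _×_; _,_; proj₁; proj₂; uncurry)
open import Data.Product.Function.NonDependent.Propositional using (_×-↔_)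
open import Function.Base using (_∘_)
open import Function.Bundles using (Inverse; Injection; Equivalence; _↔_; mk↔ₛ′)
open import Function.Definitions using (Injective)
open import Function.Properties.Inverse using (↔-refl; ↔-sym; ↔-trans; ↔⇒↣)
open import Relation.Nullary using (¬_; Dec; yes; no; contradiction)
open import Relation.Nullary.Decidable.Core using (¬¬-excluded-middle)
open import Relation.Nullary.Negation using (¬¬-map)
open import Relation.Binary.PropositionalEquality

private variable
  a b p : Level
  A : Set a
  d j k m n s : ℕ

third-element-unique : {i₁ i₂ x y : Fin 3} → i₁ ≢ i₂ →
  x ≢ i₁ → x ≢ i₂ → y ≢ i₁ → y ≢ i₂ → x ≡ y
third-element-unique i₁≢i₂ x≢i₁ x≢i₂ y≢i₁ y≢i₂ =
  punchOut-injective (x≢i₁ ∘ sym) (y≢i₁ ∘ sym)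
    (punchOut-injective
      (x≢i₂ ∘ sym ∘ punchOut-injective i₁≢i₂ (x≢i₁ ∘ sym))
      (y≢i₂ ∘ sym ∘ punchOut-injective i₁≢i₂ (y≢i₁ ∘ sym))
      (Fin1-unique _ _))
  where
    -- Punching out i₁ and then the image of i₂ leaves Fin 1.
    Fin1-unique : (i i′ : Fin 1) → i ≡ i′
    Fin1-unique zero zero = refl

¬¬-∀-Fin : ∀ n {P : Fin n → Set p} → (∀ i → ¬ ¬ P i) → ¬ ¬ (∀ i → P i)
¬¬-∀-Fin zero    _   k = k λ ()
¬¬-∀-Fin (suc n) ¬¬P k = ¬¬P zero λ P₀ → ¬¬-∀-Fin n (¬¬P ∘ suc) λ Pₛ → k (∀-cons P₀ Pₛ)

record Deduplication {A : Set a} {n : ℕ} (h : Fin n → A) : Set a where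
  field
    size           : ℕ
    pick           : Fin size → Fin n
    pick-injective : Injective _≡_ _≡_ (h ∘ pick)
    pick-covers    : ∀ i → ∃[ q ] h (pick q) ≡ h i

module _ {h : Fin (suc n) → A} (D : Deduplication (h ∘ suc)) where
  open Deduplication D

  deduplication-redundant : ∃[ q ] h zero ≡ h (suc (pick q)) → Deduplication h
  deduplication-redundant (q₀ , h₀≡) = record
    { size = size ; pick = suc ∘ pick ; pick-injective = pick-injective ; pick-covers = covers }
    where
      covers : ∀ i → ∃[ q ] h (suc (pick q)) ≡ h i
      covers zero    = q₀ , sym h₀≡
      covers (suc i) = pick-covers i

  deduplication-new : ¬ (∃[ q ] h zero ≡ h (suc (pick q))) → Deduplication h
  deduplication-new h₀-new = record
    { size = suc size ; pick = pick′ ; pick-injective = injective ; pick-covers = covers }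
    where
      pick′ : Fin (suc size) → Fin (suc n)
      pick′ zero    = zero
      pick′ (suc q) = suc (pick q)

      injective : Injective _≡_ _≡_ (h ∘ pick′)
      injective {zero}  {zero}  _  = refl
      injective {zero}  {suc j} eq = contradiction (j , eq) h₀-new
      injective {suc i} {zero}  eq = contradiction (i , sym eq) h₀-new
      injective {suc i} {suc j} eq = cong suc (pick-injective eq)

      covers : ∀ i → ∃[ q ] h (pick′ q) ≡ h i
      covers zero    = zero , refl
      covers (suc i) = let q , eq = pick-covers i in suc q , eq

deduplicate : (h : Fin n → A) → (∀ i j → Dec (h i ≡ h j)) → Deduplication h
deduplicate {n = zero}  h _    = record
  { size = 0 ; pick = λ () ; pick-injective = λ { {()} } ; pick-covers = λ () }
deduplicate {n = suc n} h _≟ₕ_ with D ← deduplicate (h ∘ suc) (λ i j → suc i ≟ₕ suc j)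
  with any? (λ q → zero ≟ₕ suc (Deduplication.pick D q))
... | yes found = deduplication-redundant D found
... | no  new   = deduplication-new D new

Vec↔Fin^ : ∀ k → Vec (Fin m) k ↔ Fin (m ^ k)
Vec↔Fin^ zero    = mk↔ₛ′ (λ _ → zero) (λ _ → []) (λ { zero → refl }) (λ { [] → refl })
Vec↔Fin^ (suc k) = ↔-trans uncons↔ (↔-trans (↔-refl ×-↔ Vec↔Fin^ k) (↔-sym *↔×))
  where
    uncons↔ : Vec A (suc k) ↔ (A × Vec A k)
    uncons↔ = mk↔ₛ′ uncons (uncurry _∷_) (λ _ → refl) (λ { (x ∷ xs) → refl })

Vec-pigeonhole : m ^ k < n ^ j → (f : Vec (Fin n) j → Vec (Fin m) k) → ¬ Injective _≡_ _≡_ f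
Vec-pigeonhole {k = k} {j = j} bound f f-injective =
  <⇒notInjective bound
    (Injection.injective (↔⇒↣ (↔-sym (Vec↔Fin^ j))) ∘ f-injective ∘
     Injection.injective (↔⇒↣ (Vec↔Fin^ k)))

module _ (G : Graph a b) where
  open Graph G

  private variable
    v : V
    x y c : ℕ → V

  walk-tail : IsWalk G (suc n) x → IsWalk G n (x ∘ suc)
  walk-tail walk i i<n = walk (suc i) (s<s i<n)

  arc-tail : IsArc G (suc n) x → IsArc G n (x ∘ suc)
  arc-tail (walk , nonbacktracking) = walk-tail walk , λ i i+2≤n → nonbacktracking (suc i) (s≤s i+2≤n)

  walk-preserves : {P : V → Set p} → (∀ {u w} → P u → E u w → P w) →
    ∀ n → IsWalk G n x → P (x 0) → P (x n)
  walk-preserves closed zero    _    P₀ = P₀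
  walk-preserves closed (suc n) walk P₀ =
    closed (walk-preserves closed n (λ i i<n → walk i (m<n⇒m<1+n i<n)) P₀) (walk n (n<1+n n))

  connected-preserves : {P : V → Set p} → Connected G → (∀ {u w} → P u → E u w → P w) →
    P v → ∀ u → P u
  connected-preserves {v = v} connected closed Pv u with connected v u
  ... | n , x , walk , refl , refl = walk-preserves closed n walk Pv

  closed-injective-family↔ : Connected G → (f : Fin m → V) → Injective _≡_ _≡_ f →
    (∀ {u w} → ∃[ q ] f q ≡ u → E u w → ∃[ q ] f q ≡ w) → Fin m → V ↔ Fin m
  closed-injective-family↔ connected f f-injective closed q₀ =
    mk↔ₛ′ (proj₁ ∘ index) f (λ q → f-injective (proj₂ (index (f q)))) (proj₂ ∘ index)
    where
      index : ∀ u → ∃[ q ] f q ≡ u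
      index = connected-preserves connected closed (q₀ , refl)

  apply : Automorphism G → V → V
  apply σ = Inverse.to (Automorphism.perm σ)

  IsRay : (ℕ → V) → Set (a ⊔ b)
  IsRay y = (∀ i → E (y i) (y (suc i))) × (∀ i → y i ≢ y (i + 2))

  ray⇒arc : IsRay y → IsArc G s y
  ray⇒arc (edge , nonbacktracking) = (λ i _ → edge i) , (λ i _ → nonbacktracking i)

  automorphism-cycle : (σ : Automorphism G) → IsCycle G n c → IsCycle G n (apply σ ∘ c)
  automorphism-cycle σ (3≤n , walk , closed , injective) =
    3≤n ,
    (λ i i<n → Equivalence.to (Automorphism.preserv σ _ _) (walk i i<n)) ,
    cong (apply σ) closed ,
    λ i j i<n j<n → injective i j i<n j<n ∘ Injection.injective (↔⇒↣ (Automorphism.perm σ))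

  cycle-arc : IsCycle G n c → k < n → IsArc G k c
  cycle-arc (_ , walk , _ , injective) k<n =
    (λ i i<k → walk i (<-trans i<k k<n)) ,
    λ i i+2≤k → <⇒≢ (m<m+n i z<s) ∘ injective i (i + 2)
                  (<-trans (m<m+n i z<s) (≤-<-trans i+2≤k k<n)) (≤-<-trans i+2≤k k<n)

  quadruple : V → V → V → V → ℕ → V
  quadruple p w u x zero                = p
  quadruple p w u x (suc zero)          = w
  quadruple p w u x (suc (suc zero))    = u
  quadruple p w u x (suc (suc (suc _))) = x

  quadruple-arc : ∀ {p w u x} → E p w → E w u → E u x → p ≢ u → w ≢ x → IsArc G 3 (quadruple p w u x)
  quadruple-arc {p} {w} {u} {x} epw ewu eux p≢u w≢x = walk , nonbacktracking
    where
      walk : IsWalk G 3 (quadruple p w u x)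
      walk zero                _ = epw
      walk (suc zero)          _ = ewu
      walk (suc (suc zero))    _ = eux
      walk (suc (suc (suc _))) (s≤s (s≤s (s≤s ())))

      nonbacktracking : ∀ i → i + 2 ≤ 3 → quadruple p w u x i ≢ quadruple p w u x (i + 2)
      nonbacktracking zero          _ = p≢u
      nonbacktracking (suc zero)    _ = w≢x
      nonbacktracking (suc (suc i)) (s≤s (s≤s i+2≤1)) =
        contradiction (m+n≤o⇒n≤o i i+2≤1) λ { (s≤s ()) }

  ArcsOnCycles : ℕ → ℕ → Set (a ⊔ b)
  ArcsOnCycles k n = ∀ x → IsArc G k x → ∃[ c ] IsCycle G n c × (∀ i → i ≤ k → c i ≡ x i)

  arcTransitive⇒arcsOnCycles : ArcTransitive G k → HasCycle G n → k < n → ArcsOnCycles k n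
  arcTransitive⇒arcsOnCycles transitive (c , c-cycle) k<n x x-arc =
    let σ , σc≡x = transitive c x (cycle-arc c-cycle k<n) x-arc
    in apply σ ∘ c , automorphism-cycle σ c-cycle , σc≡x

module CubicGraph {G : Graph a b} (cubic : Cubic G) where
  open Graph G

  private variable
    u w x z x₁ x₂ y₁ y₂ : V

  neighbour : V → Fin 3 → V
  neighbour u l = proj₁ (Inverse.from (cubic u) l)

  neighbour-adjacent : ∀ u l → E u (neighbour u l)
  neighbour-adjacent u l = proj₂ (Inverse.from (cubic u) l)

  label : E u w → Fin 3
  label {w = w} e = Inverse.to (cubic _) (w , e)

  neighbour-label : (e : E u w) → neighbour u (label e) ≡ w
  neighbour-label {w = w} e = cong proj₁ (Inverse.strictlyInverseʳ (cubic _) (w , e))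

  label-injective : (e₁ : E u x₁) (e₂ : E u x₂) → label e₁ ≡ label e₂ → x₁ ≡ x₂
  label-injective e₁ e₂ eq =
    trans (sym (neighbour-label e₁)) (trans (cong (neighbour _) eq) (neighbour-label e₂))

  neighbour-injective : ∀ {l l′} → neighbour u l ≡ neighbour u l′ → l ≡ l′
  neighbour-injective {u} {l} {l′} eq = begin
    l                                                ≡⟨ Inverse.strictlyInverseˡ (cubic u) l ⟨
    Inverse.to (cubic u) (Inverse.from (cubic u) l)  ≡⟨ cong (Inverse.to (cubic u)) (N-≡ eq _ _) ⟩
    Inverse.to (cubic u) (Inverse.from (cubic u) l′) ≡⟨ Inverse.strictlyInverseˡ (cubic u) l′ ⟩
    l′                                               ∎
    where
      open ≡-Reasoning
      N-≡ : x₁ ≡ x₂ → (e₁ : E u x₁) (e₂ : E u x₂) → _≡_ {A = N G u} (x₁ , e₁) (x₂ , e₂)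
      N-≡ refl e₁ e₂ = cong (_ ,_) (E-prop e₁ e₂)

  third-neighbour-unique : E z y₁ → E z y₂ → E z x₁ → E z x₂ → y₁ ≢ y₂ →
    x₁ ≢ y₁ → x₁ ≢ y₂ → x₂ ≢ y₁ → x₂ ≢ y₂ → x₁ ≡ x₂
  third-neighbour-unique e₁ e₂ f₁ f₂ y₁≢y₂ x₁≢y₁ x₁≢y₂ x₂≢y₁ x₂≢y₂ =
    label-injective f₁ f₂
      (third-element-unique (y₁≢y₂ ∘ label-injective e₁ e₂)
        (x₁≢y₁ ∘ label-injective f₁ e₁) (x₁≢y₂ ∘ label-injective f₁ e₂)
        (x₂≢y₁ ∘ label-injective f₂ e₁) (x₂≢y₂ ∘ label-injective f₂ e₂))

  next : E u w → V
  next {w = w} e = neighbour w (punchIn (label (E-sym e)) zero)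

  next-adjacent : (e : E u w) → E w (next e)
  next-adjacent {w = w} e = neighbour-adjacent w _

  next≢ : (e : E u w) → next e ≢ u
  next≢ e eq = punchInᵢ≢i _ zero (neighbour-injective (trans eq (sym (neighbour-label (E-sym e)))))

  ray : E u w → ℕ → V
  ray {u} e zero    = u
  ray     e (suc i) = ray (next-adjacent e) i

  ray-isRay : (e : E u w) → IsRay G (ray e)
  ray-isRay e = edge e , nonbacktracking e
    where
      edge : (e : E u w) → ∀ i → E (ray e i) (ray e (suc i))
      edge e zero    = e
      edge e (suc i) = edge (next-adjacent e) i

      nonbacktracking : (e : E u w) → ∀ i → ray e i ≢ ray e (i + 2)
      nonbacktracking e zero    = next≢ e ∘ sym
      nonbacktracking e (suc i) = nonbacktracking (next-adjacent e) i

  extend : ∀ k (x : ℕ → V) → IsWalk G (suc k) x → ℕ → V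
  extend zero    x walk i       = ray (walk 0 z<s) i
  extend (suc k) x walk zero    = x 0
  extend (suc k) x walk (suc i) = extend k (x ∘ suc) (walk-tail G walk) i

  extend-agrees : ∀ k x (walk : IsWalk G (suc k) x) i → i ≤ suc k → extend k x walk i ≡ x i
  extend-agrees zero    x walk zero          _          = refl
  extend-agrees zero    x walk (suc zero)    _          = refl
  extend-agrees zero    x walk (suc (suc i)) (s≤s ())
  extend-agrees (suc k) x walk zero          _          = refl
  extend-agrees (suc k) x walk (suc i)       (s≤s i≤k) = extend-agrees k (x ∘ suc) (walk-tail G walk) i i≤k

  extend-isRay : ∀ k x (arc : IsArc G (suc k) x) → IsRay G (extend k x (proj₁ arc))
  extend-isRay zero    x (walk , _) = ray-isRay (walk 0 z<s)
  extend-isRay (suc k) x arc@(walk , nonbacktracking) = edge , nonbacktracking′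
    where
      tail-ray : IsRay G (extend k (x ∘ suc) (walk-tail G walk))
      tail-ray = extend-isRay k (x ∘ suc) (arc-tail G arc)

      agrees : ∀ i → i ≤ suc k → extend k (x ∘ suc) (walk-tail G walk) i ≡ x (suc i)
      agrees = extend-agrees k (x ∘ suc) (walk-tail G walk)

      edge : ∀ i → E (extend (suc k) x walk i) (extend (suc k) x walk (suc i))
      edge zero    = subst (E (x 0)) (sym (agrees 0 z≤n)) (walk 0 z<s)
      edge (suc i) = proj₁ tail-ray i

      nonbacktracking′ : ∀ i → extend (suc k) x walk i ≢ extend (suc k) x walk (i + 2)
      nonbacktracking′ zero eq = nonbacktracking 0 (s≤s (s≤s z≤n)) (trans eq (agrees 1 (s≤s z≤n)))
      nonbacktracking′ (suc i) = proj₂ tail-ray i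

  arcTransitive-≤ : suc k ≤ s → ArcTransitive G s → ArcTransitive G (suc k)
  arcTransitive-≤ {k} k<s transitive x y x-arc y-arc
    with σ , σ-maps ← transitive (extend k x (proj₁ x-arc)) (extend k y (proj₁ y-arc))
                        (ray⇒arc G (extend-isRay k x x-arc)) (ray⇒arc G (extend-isRay k y y-arc)) =
    σ , λ i i≤k → begin
      apply G σ (x i)                         ≡⟨ cong (apply G σ) (extend-agrees k x (proj₁ x-arc) i i≤k) ⟨
      apply G σ (extend k x (proj₁ x-arc) i)  ≡⟨ σ-maps i (≤-trans i≤k k<s) ⟩
      extend k y (proj₁ y-arc) i              ≡⟨ extend-agrees k y (proj₁ y-arc) i i≤k ⟩
      y i                                     ∎
    where open ≡-Reasoning

  dense-injective-family⇒¬infinite : Connected G → V → (f : Fin m → V) → Injective _≡_ _≡_ f →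
    (∀ u → ¬ ¬ (∃[ q ] f q ≡ u)) → ¬ Infinite G
  dense-injective-family⇒¬infinite {m} connected v f f-injective dense infinite =
    ¬¬-∀-Fin m (λ q → ¬¬-∀-Fin 3 λ l → dense (neighbour (f q) l)) λ table →
    dense v λ (q₀ , _) → infinite m (closed-injective-family↔ G connected f f-injective (closed table) q₀)
    where
      closed : (∀ q l → ∃[ q′ ] f q′ ≡ neighbour (f q) l) →
        ∀ {u w} → ∃[ q ] f q ≡ u → E u w → ∃[ q ] f q ≡ w
      closed table (q , refl) e = let q′ , eq = table q (label e) in q′ , trans eq (neighbour-label e)

  module Balls (v₀ : V) where

    -- A word of length k encodes a walk of at most k steps from v₀: zero means stay put and suc l
    -- means go to neighbour l, so Ball k is the image of the finite set Vec (Fin 4) k.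
    walkEnd : Vec (Fin 4) k → V
    walkEnd []           = v₀
    walkEnd (zero  ∷ ls) = walkEnd ls
    walkEnd (suc l ∷ ls) = neighbour (walkEnd ls) l

    Ball : ℕ → V → Set a
    Ball k u = ∃[ ls ] walkEnd {k} ls ≡ u

    Sphere : ℕ → V → Set a
    Sphere zero    u = Ball zero u
    Sphere (suc k) u = Ball (suc k) u × ¬ Ball k u

    ball-stay : Ball k u → Ball (suc k) u
    ball-stay (ls , eq) = zero ∷ ls , eq

    ball-step : Ball k u → E u w → Ball (suc k) w
    ball-step (ls , refl) e = suc (label e) ∷ ls , neighbour-label e

    ball-centre : ∀ k → Ball k v₀
    ball-centre zero    = [] , refl
    ball-centre (suc k) = ball-stay (ball-centre k)

    ball-parent : Ball (suc k) w → ¬ Ball k w → ∃[ u ] Ball k u × E u w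
    ball-parent (zero  ∷ ls , eq)   w∉ = contradiction (ls , eq) w∉
    ball-parent (suc l ∷ ls , refl) _  = walkEnd ls , (ls , refl) , neighbour-adjacent _ l

    outside-neighbour : ¬ Ball (suc k) w → E u w → ¬ Ball k u
    outside-neighbour w∉ e u∈ = w∉ (ball-step u∈ e)

    outside≢inside : ¬ Ball k u → Ball k w → u ≢ w
    outside≢inside u∉ w∈ refl = u∉ w∈

    sphere-parent : Sphere (suc (suc k)) w → ∃[ u ] Sphere (suc k) u × E u w
    sphere-parent (w∈ , w∉) =
      let u , u∈ , e = ball-parent w∈ w∉ in u , (u∈ , outside-neighbour w∉ e) , e

    no-sphere⇒dense-ball : Connected G → (∀ x → ¬ Sphere (suc k) x) → ∀ u → ¬ ¬ Ball k u
    no-sphere⇒dense-ball {k} connected no-sphere =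
      connected-preserves G connected closed (λ v₀∉ → v₀∉ (ball-centre k))
      where
        closed : ∀ {u w} → ¬ ¬ Ball k u → E u w → ¬ ¬ Ball k w
        closed u∈ e w∉ = u∈ λ u∈′ → no-sphere _ (ball-step u∈′ e , w∉)

    dense-ball⇒¬infinite : Connected G → (∀ u → ¬ ¬ Ball k u) → ¬ Infinite G
    dense-ball⇒¬infinite {k} connected dense infinite =
      ¬¬-∀-Fin _ (λ i → ¬¬-∀-Fin _ λ j → ¬¬-excluded-middle) λ decide →
      let open Deduplication (deduplicate cover decide)
      in dense-injective-family⇒¬infinite connected v₀ (cover ∘ pick) pick-injective
           (λ u → ¬¬-map (λ (i , eq) → let q , eq′ = pick-covers i in q , trans eq′ eq) (cover-dense u))
           infinite
      where
        cover : Fin (4 ^ k) → V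
        cover = walkEnd ∘ Inverse.from (Vec↔Fin^ k)

        cover-dense : ∀ u → ¬ ¬ (∃[ i ] cover i ≡ u)
        cover-dense u = ¬¬-map (λ (ls , eq) → Inverse.to (Vec↔Fin^ k) ls ,
                                  trans (cong walkEnd (Inverse.strictlyInverseʳ (Vec↔Fin^ k) ls)) eq)
                               (dense u)

    module Hexagonal (hexagons : ArcsOnCycles G 3 6) where

      hexagon-completion : ∀ {p} → E p w → E w u → E u x → p ≢ u → w ≢ x →
        ∃₂ λ y z → E x y × E y z × E z p × u ≢ y
      hexagon-completion {w} {u} {x} {p} epw ewu eux p≢u w≢x
        with c , (_ , walk , closed , injective) , c≡ ← hexagons _ (quadruple-arc G epw ewu eux p≢u w≢x) =
        c 4 , c 5 , exy , walk 4 (s≤s (s≤s (s≤s (s≤s (s≤s z≤n))))) , ezp , u≢y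
        where
          exy : E x (c 4)
          exy = subst (λ t → E t (c 4)) (c≡ 3 (s≤s (s≤s (s≤s z≤n)))) (walk 3 (s≤s (s≤s (s≤s (s≤s z≤n)))))

          ezp : E (c 5) p
          ezp = subst (E (c 5)) (trans closed (c≡ 0 z≤n)) (walk 5 (n<1+n 5))

          u≢y : u ≢ c 4
          u≢y u≡c₄ = contradiction
            (injective 2 4 (s≤s (s≤s (s≤s z≤n))) (s≤s (s≤s (s≤s (s≤s (s≤s z≤n)))))
              (trans (c≡ 2 (s≤s (s≤s z≤n))) u≡c₄))
            λ ()

      record TwoParents (k : ℕ) (x : V) : Set (a ⊔ b) where
        field
          parent           : Fin 2 → V
          parent-adjacent  : ∀ i → E (parent i) x
          parent-sphere    : ∀ i → Sphere k (parent i)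
          parents-distinct : parent zero ≢ parent (suc zero)

        parent-injective : Injective _≡_ _≡_ parent
        parent-injective {zero}     {zero}     _  = refl
        parent-injective {zero}     {suc zero} eq = contradiction eq parents-distinct
        parent-injective {suc zero} {zero}     eq = contradiction (sym eq) parents-distinct
        parent-injective {suc zero} {suc zero} _  = refl

      two-parents : Sphere (3 + d) x → TwoParents (2 + d) x
      two-parents x-sphere@(_ , x∉)
        with u , u-sphere@(_ , u∉) , eux ← sphere-parent x-sphere
        with w , (w∈ , w∉) , ewu ← sphere-parent u-sphere
        with p , p∈ , epw ← ball-parent w∈ w∉
        with y , z , exy , eyz , ezp , u≢y ← hexagon-completion epw ewu eux
               (outside≢inside u∉ (ball-stay p∈) ∘ sym) (outside≢inside x∉ (ball-stay w∈) ∘ sym) = record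
        { parent           = λ { zero → u ; (suc zero) → y }
        ; parent-adjacent  = λ { zero → eux ; (suc zero) → E-sym exy }
        ; parent-sphere    = λ { zero → u-sphere
                               ; (suc zero) → ball-step (ball-step p∈ (E-sym ezp)) (E-sym eyz) ,
                                              outside-neighbour x∉ (E-sym exy) }
        ; parents-distinct = u≢y
        }

      outer-neighbour-unique : Sphere (3 + d) z → E z x₁ → E z x₂ →
        ¬ Ball (3 + d) x₁ → ¬ Ball (3 + d) x₂ → x₁ ≡ x₂
      outer-neighbour-unique z-sphere e₁ e₂ x₁∉ x₂∉ =
        third-neighbour-unique (E-sym (parent-adjacent zero)) (E-sym (parent-adjacent (suc zero))) e₁ e₂
          parents-distinct
          (outside≢inside x₁∉ (inner zero)) (outside≢inside x₁∉ (inner (suc zero)))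
          (outside≢inside x₂∉ (inner zero)) (outside≢inside x₂∉ (inner (suc zero)))
        where
          open TwoParents (two-parents z-sphere)
          inner : ∀ i → Ball (3 + _) (parent i)
          inner i = ball-stay (proj₁ (parent-sphere i))

      data OutwardPath (r : V) : ℕ → V → Set (a ⊔ b) where
        here    : OutwardPath r 0 r
        outward : ∀ {j c c′} → OutwardPath r j c → Sphere (3 + j) c → E c c′ → ¬ Ball (3 + j) c′ →
                  OutwardPath r (suc j) c′

      outwardPath-unique : ∀ {r c c′} → OutwardPath r j c → OutwardPath r j c′ → c ≡ c′
      outwardPath-unique here here = refl
      outwardPath-unique (outward π c-sphere e c∉) (outward π′ _ e′ c′∉)
        with refl ← outwardPath-unique π π′ = outer-neighbour-unique c-sphere e e′ c∉ c′∉

      record Ancestry (j : ℕ) (x : V) : Set (a ⊔ b) where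
        field
          ancestor           : Vec (Fin 2) j → V
          ancestor-ball      : ∀ bs → Ball 3 (ancestor bs)
          ancestor-path      : ∀ bs → OutwardPath (ancestor bs) j x
          ancestor-injective : Injective _≡_ _≡_ ancestor

      ancestry : ∀ j → Sphere (3 + j) x → Ancestry j x
      ancestry {x = x} zero (x∈ , _) = record
        { ancestor = λ _ → x ; ancestor-ball = λ _ → x∈ ; ancestor-path = λ _ → here
        ; ancestor-injective = λ { {[]} {[]} _ → refl } }
      ancestry {x = x} (suc j) x-sphere@(_ , x∉) = record
        { ancestor           = ancestor
        ; ancestor-ball      = λ { (i ∷ bs) → Ancestry.ancestor-ball (sub i) bs }
        ; ancestor-path      = λ { (i ∷ bs) → outward (Ancestry.ancestor-path (sub i) bs)
                                                  (parent-sphere i) (parent-adjacent i) x∉ }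
        ; ancestor-injective = ancestor-injective
        }
        where
          open TwoParents (two-parents x-sphere)

          sub : ∀ i → Ancestry j (parent i)
          sub i = ancestry j (parent-sphere i)

          ancestor : Vec (Fin 2) (suc j) → V
          ancestor (i ∷ bs) = Ancestry.ancestor (sub i) bs

          ancestor-injective : Injective _≡_ _≡_ ancestor
          ancestor-injective {i ∷ bs} {i′ ∷ bs′} eq
            with refl ← parent-injective (outwardPath-unique (Ancestry.ancestor-path (sub i) bs)
                          (subst (λ r → OutwardPath r j (parent i′)) (sym eq)
                            (Ancestry.ancestor-path (sub i′) bs′)))
            = cong (i ∷_) (Ancestry.ancestor-injective (sub i) eq)

      -- 4³ < 2⁷, stated as 65 ≤ 65 + 63.
      no-sphere-10 : ¬ Sphere 10 x
      no-sphere-10 x-sphere = Vec-pigeonhole (m≤m+n 65 63) word word-injective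
        where
          open Ancestry (ancestry 7 x-sphere)

          word : Vec (Fin 2) 7 → Vec (Fin 4) 3
          word bs = proj₁ (ancestor-ball bs)

          word-injective : Injective _≡_ _≡_ word
          word-injective {bs} {bs′} eq = ancestor-injective (begin
            ancestor bs         ≡⟨ proj₂ (ancestor-ball bs) ⟨
            walkEnd (word bs)   ≡⟨ cong walkEnd eq ⟩
            walkEnd (word bs′)  ≡⟨ proj₂ (ancestor-ball bs′) ⟩
            ancestor bs′        ∎)
            where open ≡-Reasoning

mainTheorem9 : ∀ {a b : Level} (s : ℕ) → 3 ≤ s → (G : Graph a b) →
    Infinite G → Connected G → Cubic G → ArcTransitive G s → Girth G 6 → ⊥
mainTheorem9 s 3≤s G infinite connected cubic transitive (hexagon@(c , _) , _) =
  dense-ball⇒¬infinite connected (no-sphere⇒dense-ball connected (λ _ → no-sphere-10)) infinite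
  where
    open CubicGraph cubic
    open Balls (c 0)
    open Hexagonal (arcTransitive⇒arcsOnCycles G (arcTransitive-≤ 3≤s transitive) hexagon (m≤m+n 4 2))
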